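{- Let $\mathcal{G}$ be a finite Abelian group (written additively) of order $|\mathcal{G}|\geq 6$ having at most one involution. Then for any elements $a,b\in\mathcal{G}$ such that $2b=0$ and $a\neq b$, there exist elements $x,y\in\mathcal{G}$ with $x\neq y$ and $\{a,b\}\cap\{x,y\}=\emptyset$ such that $x+y=b-a$.
   Context: An involution of an Abelian group $\mathcal{G}$ is an element $\iota\neq 0$ with $2\iota=0$. -}

module Defs where

open import Level using (Level)
open import Algebra.Bundles using (AbelianGroup)
open import Data.Nat using (ℕ)
open import Data.Fin using (Fin)
open import Function.Bundles using (Func; Inverse)
open import Relation.Binary.PropositionalEquality as ≡ using (_≡_)
open import Relation.Nullary using (¬_)

module _ {c ℓ : Level} (G : AbelianGroup c ℓ) where
  open AbelianGroup G

  HasOrder : ℕ → Set _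
  HasOrder n = Inverse setoid (≡.setoid (Fin n))

  IsInvolution : Carrier → Set ℓ
  IsInvolution ι = (¬ (ι ≈ ε)) Data.Product.× ((ι ∙ ι) ≈ ε)
    where import Data.Product

  AtMostOneInvolution : Set _
  AtMostOneInvolution = ∀ ι κ → IsInvolution ι → IsInvolution κ → ι ≈ κ

-- Put d = b − a. Any x with x ∉ {a, b, d − a, d − b} and 2x ≠ d gives the pair (x, d − x);
-- note d − b = −a. The solutions of 2x = d form a coset of the 2-torsion, which has at most
-- two elements, so at most six elements are excluded and a group with |G| ≥ 6 can only fail
-- if it consists of exactly these six. Then G has an involution ι, and locating b + ι among
-- the six elements either makes two of them coincide, or forces 2a = ι; in the latter case
-- every element squares into {0, ι, d}, while 2(x₀ + a) = d + ι for the root x₀ of d.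
module Submission where

open import Defs
open import Level using (Level)
open import Algebra.Bundles using (AbelianGroup)
open import Data.Nat using (ℕ; _≥_; _≤_)
open import Data.Product using (Σ; _×_; _,_; ∃; proj₁; proj₂)
open import Relation.Nullary using (¬_; yes; no; ¬?)

open import Data.Nat.Properties using (≤⇒≯; ≤-refl; ≤-trans; n≤1+n)
open import Data.Empty using (⊥; ⊥-elim)
open import Data.Fin as Fin using (Fin)
open import Data.Fin.Properties using (any?; injective⇒≤)
open import Data.List using (List; []; _∷_; _++_; length; lookup)
open import Data.List.Relation.Unary.Any as Any using (here; there; index)
open import Data.List.Relation.Unary.Any.Properties using (lookup-index; ++⁺ˡ; ++⁺ʳ)
import Data.List.Membership.Setoid as Membership
open import Data.List.Membership.Setoid.Properties using (∈-resp-≈)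
open import Data.Sum using (_⊎_; inj₁; inj₂)
open import Function using (id; _∘_)
open import Function.Bundles using (Inverse; Injection)
open import Function.Properties.Inverse using (Inverse⇒Injection)
open import Relation.Binary.Bundles using (Setoid)
open import Relation.Binary.Definitions using (Decidable; _Respects_)
open import Relation.Unary using (Pred) renaming (Decidable to Decidable₁)
open import Relation.Nullary.Decidable using (map′; _×-dec_; _⊎-dec_; decidable-stable)
import Relation.Binary.PropositionalEquality as ≡

module FiniteSetoid {c ℓ} (S : Setoid c ℓ) {n : ℕ} (S↔Fin : Inverse S (≡.setoid (Fin n))) where
  open Setoid S
  open Inverse S↔Fin using (to; from; to-cong; strictlyInverseˡ; strictlyInverseʳ)
  open Membership S using (_∈_)

  infix 4 _≟_
  _≟_ : Decidable _≈_
  x ≟ y = map′ (Injection.injective (Inverse⇒Injection S↔Fin)) to-cong (to x Fin.≟ to y)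

  ∃⊎∀¬ : ∀ {p} {P : Pred Carrier p} → Decidable₁ P → P Respects _≈_ → ∃ P ⊎ (∀ x → ¬ P x)
  ∃⊎∀¬ P? resp with any? (λ i → P? (from i))
  ... | yes (i , P[from-i]) = inj₁ (from i , P[from-i])
  ... | no ¬∃ = inj₂ λ x Px → ¬∃ (to x , resp (sym (strictlyInverseʳ x)) Px)

  covering⇒≤ : (xs : List Carrier) → (∀ x → x ∈ xs) → n ≤ length xs
  covering⇒≤ xs cover = injective⇒≤ position-injective
    where
    position : Fin n → Fin (length xs)
    position i = index (cover (from i))

    from≈lookup-position : ∀ i → from i ≈ lookup xs (position i)
    from≈lookup-position i = lookup-index (cover (from i))

    position-injective : ∀ {i j} → position i ≡.≡ position j → i ≡.≡ j
    position-injective {i} {j} eq =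
      ≡.trans (≡.sym (strictlyInverseˡ i)) (≡.trans (to-cong from-i≈from-j) (strictlyInverseˡ j))
      where
      from-i≈from-j : from i ≈ from j
      from-i≈from-j = trans (from≈lookup-position i)
        (trans (reflexive (≡.cong (lookup xs) eq)) (sym (from≈lookup-position j)))

module AbelianGroupLemmas {c ℓ} (G : AbelianGroup c ℓ) where
  open AbelianGroup G
  open import Algebra.Properties.AbelianGroup G
  open import Algebra.Properties.CommutativeSemigroup commutativeSemigroup using (interchange)

  infix 9 _²
  _² : Carrier → Carrier
  x ² = x ∙ x

  ²-cong : ∀ {x y} → x ≈ y → x ² ≈ y ²
  ²-cong x≈y = ∙-cong x≈y x≈y

  [x∙y]²≈x²∙y² : ∀ x y → (x ∙ y) ² ≈ x ² ∙ y ²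
  [x∙y]²≈x²∙y² x y = interchange x y x y

  y²≈ε⇒[x∙y]²≈x² : ∀ x {y} → y ² ≈ ε → (x ∙ y) ² ≈ x ²
  y²≈ε⇒[x∙y]²≈x² x {y} y²≈ε =
    trans ([x∙y]²≈x²∙y² x y) (trans (∙-congˡ y²≈ε) (identityʳ (x ²)))

  [x⁻¹]²≈[x²]⁻¹ : ∀ x → (x ⁻¹) ² ≈ (x ²) ⁻¹
  [x⁻¹]²≈[x²]⁻¹ x = ⁻¹-∙-comm x x

  x²≈ε⇒x⁻¹≈x : ∀ {x} → x ² ≈ ε → x ⁻¹ ≈ x
  x²≈ε⇒x⁻¹≈x {x} x²≈ε = sym (inverseʳ-unique x x x²≈ε)

  x∙[y∙x⁻¹]≈y : ∀ x y → x ∙ (y ∙ x ⁻¹) ≈ y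
  x∙[y∙x⁻¹]≈y x y = trans (sym (assoc x y (x ⁻¹))) (xyx⁻¹≈y x y)

  y∙x⁻¹≈z⇒x≈y∙z⁻¹ : ∀ {x y z} → y ∙ x ⁻¹ ≈ z → x ≈ y ∙ z ⁻¹
  y∙x⁻¹≈z⇒x≈y∙z⁻¹ {x} {y} {z} eq = x≈z//y x z y (trans (∙-congˡ (sym eq)) (x∙[y∙x⁻¹]≈y x y))

  [x∙y⁻¹]²≈ε : ∀ {x y} → x ² ≈ y ² → (x ∙ y ⁻¹) ² ≈ ε
  [x∙y⁻¹]²≈ε {x} {y} x²≈y² = begin
    (x ∙ y ⁻¹) ²  ≈⟨ [x∙y]²≈x²∙y² x (y ⁻¹) ⟩
    x ² ∙ (y ⁻¹) ² ≈⟨ ∙-cong x²≈y² ([x⁻¹]²≈[x²]⁻¹ y) ⟩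
    y ² ∙ (y ²) ⁻¹ ≈⟨ inverseʳ (y ²) ⟩
    ε              ∎
    where open import Relation.Binary.Reasoning.Setoid setoid

  IsInvolution-resp : IsInvolution G Respects _≈_
  IsInvolution-resp x≈y (x≉ε , x²≈ε) = (λ y≈ε → x≉ε (trans x≈y y≈ε)) , trans (²-cong (sym x≈y)) x²≈ε

  module _ (_≟_ : Decidable _≈_) where

    IsInvolution? : Decidable₁ (IsInvolution G)
    IsInvolution? x = ¬? (x ≟ ε) ×-dec ((x ²) ≟ ε)

    x²≈y²⇒x≈y⊎IsInvolution[x∙y⁻¹] : ∀ {x y} → x ² ≈ y ² → x ≈ y ⊎ IsInvolution G (x ∙ y ⁻¹)
    x²≈y²⇒x≈y⊎IsInvolution[x∙y⁻¹] {x} {y} x²≈y² with (x ∙ y ⁻¹) ≟ ε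
    ... | yes x∙y⁻¹≈ε = inj₁ (x∙y⁻¹≈ε⇒x≈y x y x∙y⁻¹≈ε)
    ... | no x∙y⁻¹≉ε = inj₂ (x∙y⁻¹≉ε , [x∙y⁻¹]²≈ε x²≈y²)

    x²≈y²⇒x≈y : (∀ ι → ¬ IsInvolution G ι) → ∀ {x y} → x ² ≈ y ² → x ≈ y
    x²≈y²⇒x≈y no-involution x²≈y² with x²≈y²⇒x≈y⊎IsInvolution[x∙y⁻¹] x²≈y²
    ... | inj₁ x≈y = x≈y
    ... | inj₂ involution = ⊥-elim (no-involution _ involution)

    x²≈y²⇒x≈y⊎x≈y∙ι : AtMostOneInvolution G → ∀ {ι} → IsInvolution G ι →
                       ∀ {x y} → x ² ≈ y ² → x ≈ y ⊎ x ≈ y ∙ ι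
    x²≈y²⇒x≈y⊎x≈y∙ι unique {ι} ι-involution {x} {y} x²≈y²
      with x²≈y²⇒x≈y⊎IsInvolution[x∙y⁻¹] x²≈y²
    ... | inj₁ x≈y = inj₁ x≈y
    ... | inj₂ involution = inj₂ (begin
      x                ≈⟨ //-rightDividesˡ y x ⟨
      (x ∙ y ⁻¹) ∙ y   ≈⟨ ∙-congʳ (unique _ ι involution ι-involution) ⟩
      ι ∙ y            ≈⟨ comm ι y ⟩
      y ∙ ι            ∎)
      where open import Relation.Binary.Reasoning.Setoid setoid

module Theorem {c ℓ} (G : AbelianGroup c ℓ) {n : ℕ} (order : HasOrder G n) (n≥6 : n ≥ 6)
               (unique : AtMostOneInvolution G) where
  open AbelianGroup G
  open import Algebra.Properties.AbelianGroup G
  open AbelianGroupLemmas G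
  open FiniteSetoid setoid order
  open Membership setoid using (_∈_)

  no-cover-of-length≤5 : (xs : List Carrier) → length xs ≤ 5 → ¬ (∀ x → x ∈ xs)
  no-cover-of-length≤5 xs length≤5 cover = ≤⇒≯ (≤-trans (covering⇒≤ xs cover) length≤5) n≥6

  module _ (a b : Carrier) (b²≈ε : b ² ≈ ε) (a≉b : ¬ a ≈ b) where

    d : Carrier
    d = b ∙ a ⁻¹

    d≉ε : ¬ d ≈ ε
    d≉ε d≈ε = a≉b (sym (x∙y⁻¹≈ε⇒x≈y b a d≈ε))

    d∙b⁻¹≈a⁻¹ : d ∙ b ⁻¹ ≈ a ⁻¹
    d∙b⁻¹≈a⁻¹ = trans (∙-congʳ (comm b (a ⁻¹))) (//-rightDividesʳ b (a ⁻¹))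

    exceptions : List Carrier
    exceptions = a ∷ b ∷ d ∙ a ⁻¹ ∷ a ⁻¹ ∷ []

    Bad : Pred Carrier (c Level.⊔ ℓ)
    Bad x = x ∈ exceptions ⊎ x ² ≈ d

    Bad? : Decidable₁ Bad
    Bad? x = Any.any? (x ≟_) exceptions ⊎-dec (x ² ≟ d)

    Bad-resp : Bad Respects _≈_
    Bad-resp x≈y (inj₁ x∈exceptions) = inj₁ (∈-resp-≈ setoid x≈y x∈exceptions)
    Bad-resp x≈y (inj₂ x²≈d) = inj₂ (trans (²-cong (sym x≈y)) x²≈d)

    Solution : Set (c Level.⊔ ℓ)
    Solution = Σ Carrier λ x → Σ Carrier λ y →
               ¬ (x ≈ y) × ¬ (x ≈ a) × ¬ (x ≈ b) × ¬ (y ≈ a) × ¬ (y ≈ b) × ((x ∙ y) ≈ d)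

    solution : ∀ x → ¬ Bad x → Solution
    solution x x-good =
      x , d ∙ x ⁻¹ ,
      (λ x≈d∙x⁻¹ → x-good (inj₂ (trans (∙-congˡ x≈d∙x⁻¹) (x∙[y∙x⁻¹]≈y x d)))) ,
      (λ x≈a → x-good (inj₁ (here x≈a))) ,
      (λ x≈b → x-good (inj₁ (there (here x≈b)))) ,
      (λ y≈a → x-good (inj₁ (there (there (here (y∙x⁻¹≈z⇒x≈y∙z⁻¹ y≈a)))))) ,
      (λ y≈b → x-good (inj₁ (there (there (there (here
        (trans (y∙x⁻¹≈z⇒x≈y∙z⁻¹ y≈b) d∙b⁻¹≈a⁻¹))))))) ,
      x∙[y∙x⁻¹]≈y x d

    module AllBad (all-bad : ∀ x → Bad x) where

      covered : (E R : List Carrier) → (∀ {x} → x ∈ exceptions → x ∈ E) →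
                (∀ {x} → x ² ≈ d → x ∈ R) → ∀ x → x ∈ E ++ R
      covered E R exceptions⊆E roots⊆R x with all-bad x
      ... | inj₁ x∈exceptions = ++⁺ˡ (exceptions⊆E x∈exceptions)
      ... | inj₂ x²≈d = ++⁺ʳ E (roots⊆R x²≈d)

      module SixElements (x₀ : Carrier) (x₀²≈d : x₀ ² ≈ d) (ι : Carrier) (ι-involution : IsInvolution G ι) where
        ι≉ε : ¬ ι ≈ ε
        ι≉ε = proj₁ ι-involution

        ι²≈ε : ι ² ≈ ε
        ι²≈ε = proj₂ ι-involution

        roots : List Carrier
        roots = x₀ ∷ x₀ ∙ ι ∷ []

        roots⊆roots : ∀ {x} → x ² ≈ d → x ∈ roots
        roots⊆roots x²≈d with x²≈y²⇒x≈y⊎x≈y∙ι _≟_ unique ι-involution (trans x²≈d (sym x₀²≈d))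
        ... | inj₁ x≈x₀ = here x≈x₀
        ... | inj₂ x≈x₀∙ι = there (here x≈x₀∙ι)

        everything-covered : ∀ x → x ∈ exceptions ++ roots
        everything-covered = covered exceptions roots id roots⊆roots

        x₀²≉ε : ¬ x₀ ² ≈ ε
        x₀²≉ε x₀²≈ε = d≉ε (trans (sym x₀²≈d) x₀²≈ε)

        [b∙ι]²≈ε : (b ∙ ι) ² ≈ ε
        [b∙ι]²≈ε = trans (y²≈ε⇒[x∙y]²≈x² b ι²≈ε) b²≈ε

        -- Then a = −a, so the six listed elements contain a repetition.
        a≉b∙ι : ¬ a ≈ b ∙ ι
        a≉b∙ι a≈b∙ι = no-cover-of-length≤5 (a ∷ b ∷ d ∙ a ⁻¹ ∷ roots) ≤-refl
          (covered (a ∷ b ∷ d ∙ a ⁻¹ ∷ []) roots merge-a⁻¹ roots⊆roots)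
          where
          a⁻¹≈a : a ⁻¹ ≈ a
          a⁻¹≈a = x²≈ε⇒x⁻¹≈x (trans (²-cong a≈b∙ι) [b∙ι]²≈ε)

          merge-a⁻¹ : ∀ {x} → x ∈ exceptions → x ∈ a ∷ b ∷ d ∙ a ⁻¹ ∷ []
          merge-a⁻¹ (here x≈a) = here x≈a
          merge-a⁻¹ (there (here x≈b)) = there (here x≈b)
          merge-a⁻¹ (there (there (here x≈d∙a⁻¹))) = there (there (here x≈d∙a⁻¹))
          merge-a⁻¹ (there (there (there (here x≈a⁻¹)))) = here (trans x≈a⁻¹ a⁻¹≈a)

        module OrderFour (b∙ι≈d∙a⁻¹ : b ∙ ι ≈ d ∙ a ⁻¹) where
          ι≈[a²]⁻¹ : ι ≈ (a ²) ⁻¹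
          ι≈[a²]⁻¹ = ∙-cancelˡ b ι ((a ²) ⁻¹)
            (trans b∙ι≈d∙a⁻¹ (trans (assoc b (a ⁻¹) (a ⁻¹)) (∙-congˡ ([x⁻¹]²≈[x²]⁻¹ a))))

          a²≈ι : a ² ≈ ι
          a²≈ι = trans (sym (⁻¹-involutive (a ²))) (trans (⁻¹-cong (sym ι≈[a²]⁻¹)) (x²≈ε⇒x⁻¹≈x ι²≈ε))

          [a⁻¹]²≈ι : (a ⁻¹) ² ≈ ι
          [a⁻¹]²≈ι = trans ([x⁻¹]²≈[x²]⁻¹ a) (sym ι≈[a²]⁻¹)

          squares : ∀ x → x ∈ exceptions ++ roots → x ² ∈ ε ∷ ι ∷ d ∷ []
          squares x (here x≈a) = there (here (trans (²-cong x≈a) a²≈ι))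
          squares x (there (here x≈b)) = here (trans (²-cong x≈b) b²≈ε)
          squares x (there (there (here x≈d∙a⁻¹))) =
            here (trans (²-cong (trans x≈d∙a⁻¹ (sym b∙ι≈d∙a⁻¹))) [b∙ι]²≈ε)
          squares x (there (there (there (here x≈a⁻¹)))) = there (here (trans (²-cong x≈a⁻¹) [a⁻¹]²≈ι))
          squares x (there (there (there (there (here x≈x₀))))) =
            there (there (here (trans (²-cong x≈x₀) x₀²≈d)))
          squares x (there (there (there (there (there (here x≈x₀∙ι)))))) =
            there (there (here (trans (²-cong x≈x₀∙ι) (trans (y²≈ε⇒[x∙y]²≈x² x₀ ι²≈ε) x₀²≈d))))

          [x₀∙a]²≈d∙ι : (x₀ ∙ a) ² ≈ d ∙ ι
          [x₀∙a]²≈d∙ι = trans ([x∙y]²≈x²∙y² x₀ a) (∙-cong x₀²≈d a²≈ι)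

          d²≈ι : d ² ≈ ι
          d²≈ι = trans ([x∙y]²≈x²∙y² b (a ⁻¹)) (trans (∙-cong b²≈ε [a⁻¹]²≈ι) (identityˡ ι))

          impossible : ⊥
          impossible with ∈-resp-≈ setoid [x₀∙a]²≈d∙ι (squares (x₀ ∙ a) (everything-covered (x₀ ∙ a)))
          ... | here d∙ι≈ε = ι≉ε (trans (sym d²≈ι) (trans (²-cong d≈ι) ι²≈ε))
            where
            d≈ι : d ≈ ι
            d≈ι = trans (inverseˡ-unique d ι d∙ι≈ε) (x²≈ε⇒x⁻¹≈x ι²≈ε)
          ... | there (here d∙ι≈ι) = d≉ε (identityˡ-unique d ι d∙ι≈ι)
          ... | there (there (here d∙ι≈d)) = ι≉ε (identityʳ-unique d ι d∙ι≈d)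

        impossible : ⊥
        impossible with everything-covered (b ∙ ι)
        ... | here b∙ι≈a = a≉b∙ι (sym b∙ι≈a)
        ... | there (here b∙ι≈b) = ι≉ε (identityʳ-unique b ι b∙ι≈b)
        ... | there (there (here b∙ι≈d∙a⁻¹)) = OrderFour.impossible b∙ι≈d∙a⁻¹
        ... | there (there (there (here b∙ι≈a⁻¹))) =
          a≉b∙ι (trans (sym (⁻¹-involutive a)) (trans (⁻¹-cong (sym b∙ι≈a⁻¹)) (x²≈ε⇒x⁻¹≈x [b∙ι]²≈ε)))
        ... | there (there (there (there (here b∙ι≈x₀)))) =
          x₀²≉ε (trans (²-cong (sym b∙ι≈x₀)) [b∙ι]²≈ε)
        ... | there (there (there (there (there (here b∙ι≈x₀∙ι))))) =
          x₀²≉ε (trans (²-cong (sym (∙-cancelʳ ι b x₀ b∙ι≈x₀∙ι))) b²≈ε)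

      impossible : ⊥
      impossible with ∃⊎∀¬ (λ x → x ² ≟ d) (λ x≈y x²≈d → trans (²-cong (sym x≈y)) x²≈d)
      ... | inj₂ no-root = no-cover-of-length≤5 exceptions (n≤1+n 4)
        (covered exceptions [] id (λ {x} x²≈d → ⊥-elim (no-root x x²≈d)))
      ... | inj₁ (x₀ , x₀²≈d) with ∃⊎∀¬ (IsInvolution? _≟_) IsInvolution-resp
      ...   | inj₁ (ι , ι-involution) = SixElements.impossible x₀ x₀²≈d ι ι-involution
      ...   | inj₂ no-involution = no-cover-of-length≤5 (exceptions ++ x₀ ∷ []) ≤-refl
        (covered exceptions (x₀ ∷ []) id
          (λ x²≈d → here (x²≈y²⇒x≈y _≟_ no-involution (trans x²≈d (sym x₀²≈d)))))

    solution-exists : Solution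
    solution-exists with ∃⊎∀¬ (¬? ∘ Bad?) (λ x≈y x-good y-bad → x-good (Bad-resp (sym x≈y) y-bad))
    ... | inj₁ (x , x-good) = solution x x-good
    ... | inj₂ none-good = ⊥-elim (AllBad.impossible (λ x → decidable-stable (Bad? x) (none-good x)))

lemma3 : {c ℓ : Level} (G : AbelianGroup c ℓ) (n : ℕ) → HasOrder G n → n ≥ 6 →
         AtMostOneInvolution G →
         let open AbelianGroup G in
         (a b : Carrier) → (b ∙ b) ≈ ε → ¬ (a ≈ b) →
         Σ Carrier λ x → Σ Carrier λ y →
           ¬ (x ≈ y) × ¬ (x ≈ a) × ¬ (x ≈ b) × ¬ (y ≈ a) × ¬ (y ≈ b) ×
           ((x ∙ y) ≈ (b ∙ (a ⁻¹)))
lemma3 G n order n≥6 unique = Theorem.solution-exists G order n≥6 unique
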